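{- For every integer $n \geq 1$, the number of Catalan descending plane partitions of order $n$ equals the $n$th Catalan number \[C_n = \frac{1}{n+1}\binom{2n}{n}.\]
   Context: A one-row descending plane partition is either the empty sequence $\emptyset$, or a finite sequence of positive integers $a_1 \geq a_2 \geq \cdots \geq a_\lambda$ (with $\lambda \geq 1$) whose number of parts is less than its greatest part, i.e. $\lambda < a_1$. A Catalan descending plane partition is a one-row descending plane partition $a_1\, a_2 \cdots a_\lambda$ such that $a_j \leq a_1 - j + 1$ for every $j = 1, \ldots, \lambda$ (the empty sequence is also a Catalan descending plane partition). It is of order $n$ if its largest part is at most $n$ (the empty one is of every order $n$). For example, the Catalan descending plane partitions of order $4$ are $\emptyset$, $2$, $3$, $31$, $32$, $4$, $41$, $42$, $43$, $411$, $421$, $431$, $422$, $432$. -}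

module Defs where

open import Data.Nat using (ℕ; zero; suc; _+_; _∸_; _≤_; _<_; _≥_; _/_)
open import Data.Nat.Combinatorics using (_C_)
open import Data.List using (List; []; _∷_; length)
open import Data.List.Relation.Unary.All using (All)
open import Data.List.Relation.Unary.Linked using (Linked)
open import Data.Product using (_×_; Σ)
open import Data.Unit using (⊤)

catalan : ℕ → ℕ
catalan n = ((2 * n) C n) / suc n
  where open import Data.Nat using (_*_)

OneRowDPP : List ℕ → Set
OneRowDPP [] = ⊤
OneRowDPP (a₁ ∷ as) =
  All (λ a → 1 ≤ a) (a₁ ∷ as) × Linked _≥_ (a₁ ∷ as) × length (a₁ ∷ as) < a₁

-- CatBound a₁ j xs : the entries of xs, sitting at positions j, j+1, ...
-- (1-based), satisfy a_i ≤ a₁ - i + 1.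
CatBound : ℕ → ℕ → List ℕ → Set
CatBound a₁ j [] = ⊤
CatBound a₁ j (x ∷ xs) = (x + j ≤ a₁ + 1) × CatBound a₁ (suc j) xs

CatalanCond : List ℕ → Set
CatalanCond [] = ⊤
CatalanCond (a₁ ∷ as) = CatBound a₁ 1 (a₁ ∷ as)

OfOrder : ℕ → List ℕ → Set
OfOrder n [] = ⊤
OfOrder n (a₁ ∷ as) = a₁ ≤ n

CatalanDPP : ℕ → List ℕ → Set
CatalanDPP n xs = OneRowDPP xs × CatalanCond xs × OfOrder n xs

CatalanDPPs : ℕ → Set
CatalanDPPs n = Σ (List ℕ) (CatalanDPP n)

-- A Catalan DPP is empty or starts with its largest part a ≥ 2, after which the
-- possible continuations depend only on the bound imposed by the previous part and
-- on the number of positions still available.  Splitting on whether the next part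
-- attains its bound gives Pascal-like recurrences, solved by the ballot numbers
-- C(k+b, b) − C(k+b, k+3); summing over a then yields C(2n, n) − C(2n, n+1), which
-- is the n-th Catalan number by the absorption identity.
module Submission where

open import Defs
open import Data.Nat using (ℕ; _≥_)
open import Data.Fin using (Fin)
open import Function.Bundles using (_↔_)

open import Data.Nat
open import Data.Nat.Properties
open import Data.Nat.Combinatorics using (_C_; nC1≡n; nCk≡nC[n∸k]; k>n⇒nCk≡0)
  renaming (nCk+nC[k+1]≡[n+1]C[k+1] to pascal)
open import Data.Nat.DivMod using (m*n/n≡m)
open import Algebra.Properties.CommutativeSemigroup +-commutativeSemigroup
  using (interchange; x∙yz≈y∙xz)
open import Data.List using (List; []; _∷_; length)
open import Data.List.Relation.Unary.All using (All; []; _∷_)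
import Data.List.Relation.Unary.All as All
open import Data.List.Relation.Unary.Linked using (Linked; [-]; _∷_)
import Data.List.Relation.Unary.Linked as Linked
open import Data.Product using (Σ; _×_; _,_)
open import Data.Sum using (_⊎_; inj₁; inj₂)
open import Data.Sum.Function.Propositional using (_⊎-↔_)
open import Data.Unit using (⊤; tt)
open import Data.Empty using (⊥; ⊥-elim)
open import Data.Fin.Properties using (+↔⊎)
open import Function.Bundles using (mk↔ₛ′)
open import Function.Properties.Inverse using (↔-trans; ↔-sym)
open import Relation.Nullary using (¬_; yes; no)
open import Relation.Unary using (Irrelevant)
open import Relation.Binary.PropositionalEquality
open ≡-Reasoning

C-symmetric : ∀ {n} a b → a + b ≡ n → n C a ≡ n C b
C-symmetric a b refl = begin
  (a + b) C a             ≡⟨ nCk≡nC[n∸k] (m≤m+n a b) ⟩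
  (a + b) C (a + b ∸ a)   ≡⟨ cong ((a + b) C_) (m+n∸m≡n a b) ⟩
  (a + b) C b             ∎

[k+1]*[n+1]C[k+1]≡[n+1]*nCk : ∀ n k → suc k * (suc n C suc k) ≡ suc n * (n C k)
[k+1]*[n+1]C[k+1]≡[n+1]*nCk zero    zero    = refl
[k+1]*[n+1]C[k+1]≡[n+1]*nCk zero    (suc k) = *-zeroʳ (suc (suc k))
[k+1]*[n+1]C[k+1]≡[n+1]*nCk (suc n) zero    = begin
  1 * (suc (suc n) C 1) ≡⟨ *-identityˡ _ ⟩
  suc (suc n) C 1       ≡⟨ nC1≡n (suc (suc n)) ⟩
  suc (suc n)           ≡⟨ *-identityʳ (suc (suc n)) ⟨
  suc (suc n) * 1       ∎
[k+1]*[n+1]C[k+1]≡[n+1]*nCk (suc n) (suc k) = begin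
  suc (suc k) * (suc (suc n) C suc (suc k))  ≡⟨ cong (suc (suc k) *_) (pascal (suc n) (suc k)) ⟨
  suc (suc k) * (X + Y)                      ≡⟨ *-distribˡ-+ (suc (suc k)) X Y ⟩
  (X + suc k * X) + suc (suc k) * Y          ≡⟨ +-assoc X (suc k * X) _ ⟩
  X + (suc k * X + suc (suc k) * Y)          ≡⟨ cong (X +_) (cong₂ _+_ ([k+1]*[n+1]C[k+1]≡[n+1]*nCk n k)
                                                                      ([k+1]*[n+1]C[k+1]≡[n+1]*nCk n (suc k))) ⟩
  X + (suc n * (n C k) + suc n * (n C suc k)) ≡⟨ cong (X +_) (*-distribˡ-+ (suc n) (n C k) (n C suc k)) ⟨
  X + suc n * (n C k + n C suc k)            ≡⟨ cong (λ z → X + suc n * z) (pascal n k) ⟩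
  suc (suc n) * X                            ∎
  where
  X = suc n C suc k
  Y = suc n C suc (suc k)

central-absorption : ∀ n → suc n * ((n + n) C suc n) ≡ n * ((n + n) C n)
central-absorption zero    = refl
central-absorption (suc n) = begin
  suc (suc n) * (suc N C suc (suc n)) ≡⟨ [k+1]*[n+1]C[k+1]≡[n+1]*nCk N (suc n) ⟩
  suc N * (N C suc n)                 ≡⟨ cong (suc N *_) (C-symmetric (suc n) n (+-comm (suc n) n)) ⟩
  suc N * (N C n)                     ≡⟨ [k+1]*[n+1]C[k+1]≡[n+1]*nCk N n ⟨
  suc n * (suc N C suc n)             ∎
  where N = n + suc n

catalan-from-ballot : ∀ n d → d + (n + n) C suc n ≡ (n + n) C n → catalan n ≡ d
catalan-from-ballot n d ballot = begin
  catalan n                ≡⟨ cong (λ m → ((n + m) C n) / suc n) (+-identityʳ n) ⟩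
  X / suc n                ≡⟨ cong (_/ suc n) X≡d*[n+1] ⟩
  d * suc n / suc n        ≡⟨ m*n/n≡m d (suc n) ⟩
  d                        ∎
  where
  X = (n + n) C n
  Y = (n + n) C suc n
  X≡d*[n+1] : X ≡ d * suc n
  X≡d*[n+1] = +-cancelʳ-≡ (n * X) X (d * suc n) (begin
    suc n * X                 ≡⟨ cong (suc n *_) ballot ⟨
    suc n * (d + Y)           ≡⟨ *-distribˡ-+ (suc n) d Y ⟩
    suc n * d + suc n * Y     ≡⟨ cong₂ _+_ (*-comm (suc n) d) (central-absorption n) ⟩
    d * suc n + n * X         ∎)

pascal-split : ∀ a b m r → a + b + suc m C suc r ≡ (a + m C suc r) + (b + m C r)
pascal-split a b m r = begin
  a + b + suc m C suc r               ≡⟨ cong (a + b +_) (pascal m r) ⟨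
  (a + b) + (m C r + m C suc r)       ≡⟨ cong (a + b +_) (+-comm (m C r) (m C suc r)) ⟩
  (a + b) + (m C suc r + m C r)       ≡⟨ interchange a b (m C suc r) (m C r) ⟩
  (a + m C suc r) + (b + m C r)       ∎

pascal-shift : ∀ t m r → t + m C suc (suc r) ≡ m C r → t + suc m C suc (suc r) ≡ suc m C suc r
pascal-shift t m r hyp = begin
  t + suc m C suc (suc r)               ≡⟨ cong (t +_) (pascal m (suc r)) ⟨
  t + (m C suc r + m C suc (suc r))     ≡⟨ x∙yz≈y∙xz t (m C suc r) _ ⟩
  m C suc r + (t + m C suc (suc r))     ≡⟨ cong (m C suc r +_) hyp ⟩
  m C suc r + m C r                     ≡⟨ +-comm (m C suc r) (m C r) ⟩
  m C r + m C suc r                     ≡⟨ pascal m r ⟩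
  suc m C suc r                         ∎

module _ {P : List ℕ → Set} (P-irrelevant : Irrelevant P) where

  Σ-≡ : ∀ {xs ys} {p : P xs} {q : P ys} → xs ≡ ys → _≡_ {A = Σ (List ℕ) P} (xs , p) (ys , q)
  Σ-≡ refl = cong (_ ,_) (P-irrelevant _ _)

  only-[]⇒↔Fin1 : P [] → (∀ {x xs} → ¬ P (x ∷ xs)) → Σ (List ℕ) P ↔ Fin 1
  only-[]⇒↔Fin1 p[] no-cons =
    mk↔ₛ′ (λ _ → Fin.zero) (λ _ → [] , p[]) (λ { Fin.zero → refl ; (Fin.suc ()) }) from∘to
    where
    from∘to : ∀ y → ([] , p[]) ≡ y
    from∘to ([]     , p) = Σ-≡ refl
    from∘to (x ∷ xs , p) = ⊥-elim (no-cons p)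

  Σ-cong-irrelevant : ∀ {Q : List ℕ → Set} → Irrelevant Q →
    (∀ {xs} → P xs → Q xs) → (∀ {xs} → Q xs → P xs) → Σ (List ℕ) P ↔ Σ (List ℕ) Q
  Σ-cong-irrelevant Q-irrelevant P⇒Q Q⇒P = mk↔ₛ′
    (λ (xs , p) → xs , P⇒Q p) (λ (xs , q) → xs , Q⇒P q)
    (λ (xs , q) → cong (xs ,_) (Q-irrelevant _ _)) (λ (xs , p) → cong (xs ,_) (P-irrelevant _ _))

↔Fin-+ : ∀ {A B C : Set} {m n} → A ↔ (B ⊎ C) → B ↔ Fin m → C ↔ Fin n → A ↔ Fin (m + n)
↔Fin-+ A↔B⊎C B↔m C↔n = ↔-trans A↔B⊎C (↔-trans (B↔m ⊎-↔ C↔n) (↔-sym +↔⊎))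

HeadBounded : (ℕ → Set) → (ℕ → List ℕ → Set) → ℕ → List ℕ → Set
HeadBounded Q R b []       = ⊤
HeadBounded Q R b (x ∷ xs) = Q x × x ≤ b × R x xs

module _ {Q : ℕ → Set} {R : ℕ → List ℕ → Set}
         (Q-irrelevant : Irrelevant Q) (R-irrelevant : ∀ {x} → Irrelevant (R x)) where

  HeadBounded-irrelevant : ∀ {b} → Irrelevant (HeadBounded Q R b)
  HeadBounded-irrelevant {x = []}    tt          tt             = refl
  HeadBounded-irrelevant {x = _ ∷ _} (q , le , r) (q′ , le′ , r′) =
    cong₂ _,_ (Q-irrelevant q q′) (cong₂ _,_ (≤-irrelevant le le′) (R-irrelevant r r′))

  HeadBounded-split : ∀ {c} → Q (suc c) →
    Σ (List ℕ) (HeadBounded Q R (suc c)) ↔ (Σ (List ℕ) (HeadBounded Q R c) ⊎ Σ (List ℕ) (R (suc c)))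
  HeadBounded-split {c} q₁₊c = mk↔ₛ′ to from to∘from from∘to
    where
    A = Σ (List ℕ) (HeadBounded Q R (suc c))
    B = Σ (List ℕ) (HeadBounded Q R c) ⊎ Σ (List ℕ) (R (suc c))

    to : A → B
    to ([]     , tt)             = inj₁ ([] , tt)
    to (x ∷ xs , q , x≤1+c , r) with x ≤? c
    ... | yes x≤c = inj₁ (x ∷ xs , q , x≤c , r)
    ... | no  x≰c = inj₂ (xs , subst (λ y → R y xs) (≤-antisym x≤1+c (≰⇒> x≰c)) r)

    from : B → A
    from (inj₁ ([]     , tt))        = [] , tt
    from (inj₁ (x ∷ xs , q , x≤c , r)) = x ∷ xs , q , m≤n⇒m≤1+n x≤c , r
    from (inj₂ (xs , r))             = suc c ∷ xs , q₁₊c , ≤-refl , r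

    to∘from : ∀ y → to (from y) ≡ y
    to∘from (inj₁ ([]     , tt)) = refl
    to∘from (inj₁ (x ∷ xs , q , x≤c , r)) with x ≤? c
    ... | yes _   = cong inj₁ (Σ-≡ HeadBounded-irrelevant refl)
    ... | no  x≰c = ⊥-elim (x≰c x≤c)
    to∘from (inj₂ (xs , r)) with suc c ≤? c
    ... | yes 1+c≤c = ⊥-elim (1+n≰n 1+c≤c)
    ... | no  _     = cong inj₂ (Σ-≡ R-irrelevant refl)

    from∘to : ∀ y → from (to y) ≡ y
    from∘to ([]     , tt) = refl
    from∘to (x ∷ xs , q , x≤1+c , r) with x ≤? c
    ... | yes _   = Σ-≡ HeadBounded-irrelevant refl
    ... | no  x≰c = Σ-≡ HeadBounded-irrelevant (cong (_∷ xs) (≤-antisym (≰⇒> x≰c) x≤1+c))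

  HeadBounded-none : ∀ {b} → (∀ {x} → x ≤ b → ¬ Q x) → Σ (List ℕ) (HeadBounded Q R b) ↔ Fin 1
  HeadBounded-none no-head = only-[]⇒↔Fin1 HeadBounded-irrelevant tt (λ (q , x≤b , _) → no-head x≤b q)

-- Tail k b: the possible continuations of a Catalan DPP at a position with room for
-- at most k more parts; the next part is at most b, and b never exceeds the Catalan
-- cap k + 1 of that position.
Tail : ℕ → ℕ → List ℕ → Set
Tail zero    b []      = ⊤
Tail zero    b (_ ∷ _) = ⊥
Tail (suc k) b xs      = HeadBounded (1 ≤_) (λ x → Tail k (x ⊓ suc k)) b xs

-- After a largest part a there is room for a − 2 more parts, each at most a − 1.
DPP : ℕ → List ℕ → Set
DPP = HeadBounded (2 ≤_) (λ a → Tail (a ∸ 2) (pred a))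

tails : ℕ → ℕ → ℕ
tails zero    b       = 1
tails (suc k) zero    = 1
tails (suc k) (suc c) = tails (suc k) c + tails k (suc c ⊓ suc k)

dpps : ℕ → ℕ
dpps zero          = 1
dpps (suc zero)    = 1
dpps (suc (suc n)) = dpps (suc n) + tails n (suc n)

Tail-irrelevant : ∀ k b → Irrelevant (Tail k b)
Tail-irrelevant zero    b {[]}    tt tt = refl
Tail-irrelevant zero    b {_ ∷ _} ()
Tail-irrelevant (suc k) b           = HeadBounded-irrelevant ≤-irrelevant λ {x} → Tail-irrelevant k (x ⊓ suc k)

DPP-irrelevant : ∀ n → Irrelevant (DPP n)
DPP-irrelevant n = HeadBounded-irrelevant ≤-irrelevant λ {a} → Tail-irrelevant (a ∸ 2) (pred a)

Tail↔tails : ∀ k b → Σ (List ℕ) (Tail k b) ↔ Fin (tails k b)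
Tail↔tails zero    b       = only-[]⇒↔Fin1 (λ {xs} → Tail-irrelevant zero b {xs}) tt λ ()
Tail↔tails (suc k) zero    =
  HeadBounded-none ≤-irrelevant (λ {x} → Tail-irrelevant k (x ⊓ suc k)) λ { z≤n () }
Tail↔tails (suc k) (suc c) =
  ↔Fin-+ (HeadBounded-split ≤-irrelevant (λ {x} → Tail-irrelevant k (x ⊓ suc k)) (s≤s z≤n))
         (Tail↔tails (suc k) c) (Tail↔tails k (suc c ⊓ suc k))

DPP↔dpps : ∀ n → Σ (List ℕ) (DPP n) ↔ Fin (dpps n)
DPP↔dpps zero          =
  HeadBounded-none ≤-irrelevant (λ {a} → Tail-irrelevant (a ∸ 2) (pred a)) λ { z≤n () }
DPP↔dpps (suc zero)    =
  HeadBounded-none ≤-irrelevant (λ {a} → Tail-irrelevant (a ∸ 2) (pred a))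
                   λ x≤1 2≤x → 1+n≰n (≤-trans 2≤x x≤1)
DPP↔dpps (suc (suc n)) =
  ↔Fin-+ (HeadBounded-split ≤-irrelevant (λ {a} → Tail-irrelevant (a ∸ 2) (pred a)) (s≤s (s≤s z≤n)))
         (DPP↔dpps (suc n)) (Tail↔tails n (suc n))

tails-ballot-step : ∀ k c → c ≤ suc k
  → (∀ b → b ≤ suc k → tails k b + (k + b) C (3 + k) ≡ (k + b) C b)
  → tails (suc k) c + (suc k + c) C (4 + k) ≡ (suc k + c) C c
  → tails (suc k) (suc c) + (suc k + suc c) C (4 + k) ≡ (suc k + suc c) C suc c
tails-ballot-step k c c≤1+k ih ih-c with m≤n⇒m<n∨m≡n c≤1+k
... | inj₁ (s≤s c≤k) = begin
  tails (suc k) c + tails k (suc c ⊓ suc k) + suc N C suc (3 + k)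
    ≡⟨ cong (λ z → tails (suc k) c + tails k z + suc N C suc (3 + k)) (m≤n⇒m⊓n≡m (s≤s c≤k)) ⟩
  tails (suc k) c + tails k (suc c) + suc N C suc (3 + k)
    ≡⟨ pascal-split (tails (suc k) c) (tails k (suc c)) N (3 + k) ⟩
  (tails (suc k) c + N C (4 + k)) + (tails k (suc c) + N C (3 + k))
    ≡⟨ cong₂ _+_ (subst (λ m → tails (suc k) c + m C (4 + k) ≡ m C c) (sym (+-suc k c)) ih-c)
                 (ih (suc c) (s≤s c≤k)) ⟩
  N C c + N C suc c
    ≡⟨ pascal N c ⟩
  suc N C suc c ∎
  where N = k + suc c
... | inj₂ refl rewrite +-suc k (suc k) = begin
  tails (suc k) (suc k) + tails k (suc (suc k) ⊓ suc k) + suc (suc N) C suc (3 + k)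
    ≡⟨ cong (λ z → tails (suc k) (suc k) + tails k z + suc (suc N) C suc (3 + k))
            (m≥n⇒m⊓n≡n (n≤1+n (suc k))) ⟩
  tails (suc k) (suc k) + tails k (suc k) + suc (suc N) C suc (3 + k)
    ≡⟨ pascal-split (tails (suc k) (suc k)) (tails k (suc k)) (suc N) (3 + k) ⟩
  (tails (suc k) (suc k) + suc N C (4 + k)) + (tails k (suc k) + suc N C (3 + k))
    ≡⟨ cong₂ _+_ ih-c (pascal-shift (tails k (suc k)) N (suc k) (ih (suc k) ≤-refl)) ⟩
  suc N C suc k + suc N C suc (suc k)
    ≡⟨ pascal (suc N) (suc k) ⟩
  suc (suc N) C suc (suc k) ∎
  where N = k + suc k

tails-ballot : ∀ k b → b ≤ suc k → tails k b + (k + b) C (3 + k) ≡ (k + b) C b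
tails-ballot zero    zero          _               = refl
tails-ballot zero    (suc zero)    _               = refl
tails-ballot zero    (suc (suc b)) (s≤s ())
tails-ballot (suc k) zero          _               =
  cong suc (k>n⇒nCk≡0 (s≤s (≤-trans (≤-reflexive (+-identityʳ (suc k))) (m≤n+m (suc k) 2))))
tails-ballot (suc k) (suc c)       (s≤s c≤1+k)     =
  tails-ballot-step k c c≤1+k (tails-ballot k) (tails-ballot (suc k) c (m≤n⇒m≤1+n c≤1+k))

dpps-ballot-step : ∀ n → dpps (suc n) + (suc n + suc n) C (2 + n) ≡ (suc n + suc n) C (1 + n)
  → dpps (2 + n) + (2 + n + (2 + n)) C (3 + n) ≡ (2 + n + (2 + n)) C (2 + n)
dpps-ballot-step n ih rewrite +-suc n (suc n) = begin
  d + t + suc (suc P) C (3 + n)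
    ≡⟨ cong (d + t +_) (pascal (suc P) (2 + n)) ⟨
  d + t + (suc P C (2 + n) + suc P C (3 + n))
    ≡⟨ x∙yz≈y∙xz (d + t) (suc P C (2 + n)) (suc P C (3 + n)) ⟩
  suc P C (2 + n) + (d + t + suc P C (3 + n))
    ≡⟨ cong (λ z → suc P C (2 + n) + (z + suc P C (3 + n))) (+-comm d t) ⟩
  suc P C (2 + n) + (t + d + suc P C (3 + n))
    ≡⟨ cong (suc P C (2 + n) +_) (pascal-split t d P (2 + n)) ⟩
  suc P C (2 + n) + ((t + P C (3 + n)) + (d + P C (2 + n)))
    ≡⟨ cong (suc P C (2 + n) +_) (cong₂ _+_ t-ballot ih) ⟩
  suc P C (2 + n) + (P C n + P C (1 + n))
    ≡⟨ cong (suc P C (2 + n) +_) (pascal P n) ⟩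
  suc P C (2 + n) + suc P C (1 + n)
    ≡⟨ +-comm (suc P C (2 + n)) (suc P C (1 + n)) ⟩
  suc P C (1 + n) + suc P C (2 + n)
    ≡⟨ pascal (suc P) (1 + n) ⟩
  suc (suc P) C (2 + n) ∎
  where
  d = dpps (suc n)
  t = tails n (suc n)
  P = suc n + suc n
  t-ballot : t + P C (3 + n) ≡ P C n
  t-ballot = begin
    t + P C (3 + n)  ≡⟨ pascal-shift t (n + suc n) (suc n) (tails-ballot n (suc n) ≤-refl) ⟩
    P C (2 + n)      ≡⟨ C-symmetric n (2 + n) (+-suc n (suc n)) ⟨
    P C n            ∎

dpps-ballot : ∀ n → dpps n + (n + n) C suc n ≡ (n + n) C n
dpps-ballot zero          = refl
dpps-ballot (suc zero)    = refl
dpps-ballot (suc (suc n)) = dpps-ballot-step n (dpps-ballot (suc n))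

-- xs fills positions j, j + 1, … of a Catalan DPP with largest part a, after a part p.
DPPSuffix : ℕ → ℕ → ℕ → List ℕ → Set
DPPSuffix a j p xs = All (1 ≤_) xs × Linked _≥_ (p ∷ xs) × j + length xs ≤ a × CatBound a j xs

cap⇒CatBound : ∀ {x m} j → x ≤ suc m → x + j ≤ m + j + 1
cap⇒CatBound {x} {m} j x≤1+m = subst (x + j ≤_) (+-comm 1 (m + j)) (+-monoˡ-≤ j x≤1+m)

CatBound⇒cap : ∀ {x m} j → x + j ≤ m + j + 1 → x ≤ suc m
CatBound⇒cap {x} {m} j x+j≤m+j+1 =
  +-cancelʳ-≤ j x (suc m) (subst (x + j ≤_) (+-comm (m + j) 1) x+j≤m+j+1)

Tail⇒DPPSuffix : ∀ k {a j p b} xs → k + j ≡ a → b ≤ p → b ≤ suc k → Tail k b xs → DPPSuffix a j p xs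
Tail⇒DPPSuffix k {j = j} [] refl _ _ _ = [] , [-] , ≤-trans (≤-reflexive (+-identityʳ j)) (m≤n+m j k) , tt
Tail⇒DPPSuffix (suc k) {j = j} (x ∷ xs) refl b≤p b≤2+k (1≤x , x≤b , tail)
  with Tail⇒DPPSuffix k xs (+-suc k j) (m⊓n≤m x (suc k)) (m⊓n≤n x (suc k)) tail
... | positive , linked , short , capped =
  1≤x ∷ positive , ≤-trans x≤b b≤p ∷ linked , subst (_≤ suc k + j) (sym (+-suc j (length xs))) short ,
  cap⇒CatBound j (≤-trans x≤b b≤2+k) , capped

DPPSuffix⇒Tail : ∀ k {a j p b} xs → k + j ≡ a → p ⊓ suc k ≤ b → DPPSuffix a j p xs → Tail k b xs
DPPSuffix⇒Tail zero    []       _    _ _ = tt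
DPPSuffix⇒Tail (suc k) []       _    _ _ = tt
DPPSuffix⇒Tail zero    {j = j} (x ∷ xs) refl _ (_ , _ , short , _) = m+1+n≰m j short
DPPSuffix⇒Tail (suc k) {j = j} (x ∷ xs) refl p⊓2+k≤b
               (1≤x ∷ positive , x≤p ∷ linked , short , x-capped , capped) =
  1≤x , ≤-trans (⊓-glb x≤p (CatBound⇒cap j x-capped)) p⊓2+k≤b ,
  DPPSuffix⇒Tail k xs (+-suc k j) ≤-refl
    (positive , linked , subst (_≤ suc k + j) (+-suc j (length xs)) short , capped)

CatBound-irrelevant : ∀ a j → Irrelevant (CatBound a j)
CatBound-irrelevant a j {[]}    tt       tt         = refl
CatBound-irrelevant a j {_ ∷ _} (le , c) (le′ , c′) =
  cong₂ _,_ (≤-irrelevant le le′) (CatBound-irrelevant a (suc j) c c′)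

CatalanDPP-irrelevant : ∀ n → Irrelevant (CatalanDPP n)
CatalanDPP-irrelevant n {[]}    (tt , tt , tt) (tt , tt , tt) = refl
CatalanDPP-irrelevant n {a ∷ _} ((p , l , s) , c , o) ((p′ , l′ , s′) , c′ , o′) =
  cong₂ _,_
    (cong₂ _,_ (All.irrelevant ≤-irrelevant p p′)
               (cong₂ _,_ (Linked.irrelevant ≤-irrelevant l l′) (≤-irrelevant s s′)))
    (cong₂ _,_ (CatBound-irrelevant a 1 c c′) (≤-irrelevant o o′))

CatalanDPP⇒DPP : ∀ {n} xs → CatalanDPP n xs → DPP n xs
CatalanDPP⇒DPP []                 _                         = tt
CatalanDPP⇒DPP (zero ∷ _)         ((_ , _ , ()) , _)
CatalanDPP⇒DPP (suc zero ∷ _)     ((_ , _ , s≤s ()) , _)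
CatalanDPP⇒DPP (suc (suc k) ∷ xs) ((_ ∷ positive , linked , short) , (_ , capped) , a≤n) =
  s≤s (s≤s z≤n) , a≤n ,
  DPPSuffix⇒Tail k xs (+-comm k 2) (m⊓n≤n (suc (suc k)) (suc k)) (positive , linked , short , capped)

DPP⇒CatalanDPP : ∀ {n} xs → DPP n xs → CatalanDPP n xs
DPP⇒CatalanDPP []                 _ = tt , tt , tt
DPP⇒CatalanDPP (zero ∷ _)         (() , _)
DPP⇒CatalanDPP (suc zero ∷ _)     (s≤s () , _)
DPP⇒CatalanDPP (suc (suc k) ∷ xs) (_ , a≤n , tail)
  with Tail⇒DPPSuffix k xs (+-comm k 2) (n≤1+n (suc k)) ≤-refl tail
... | positive , linked , short , capped =
  (s≤s z≤n ∷ positive , linked , short) , (≤-refl , capped) , a≤n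

CatalanDPPs↔DPPs : ∀ n → CatalanDPPs n ↔ Σ (List ℕ) (DPP n)
CatalanDPPs↔DPPs n =
  Σ-cong-irrelevant (CatalanDPP-irrelevant n) (DPP-irrelevant n) (CatalanDPP⇒DPP _) (DPP⇒CatalanDPP _)

-- The count is also correct for n = 0.
theorem3p2 : (n : ℕ) → n ≥ 1 → Fin (catalan n) ↔ CatalanDPPs n
theorem3p2 n _ rewrite catalan-from-ballot n (dpps n) (dpps-ballot n) =
  ↔-sym (↔-trans (CatalanDPPs↔DPPs n) (DPP↔dpps n))
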